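{- Let $X$ be a connected $k$-regular graph, $v_0$ a vertex of $X$, and $\Lambda$ a group acting on $X$ by graph automorphisms. Let $C=\mathrm{Stab}_\Lambda(v_0)$ and $S=\{g\in\Lambda : \mathrm{dist}(g.v_0,v_0)=1\}$. If $|S/C|=k$, then $\Lambda$ acts transitively on the vertices of $X$.
   Context: $\mathrm{dist}$ is the graph distance on vertices; $S/C$ denotes the set of cosets $\{sC: s\in S\}$ (note $S$ is right $C$-invariant). -}

module Defs where

open import Level using (Level; _⊔_) renaming (suc to lsuc)
open import Data.Nat using (ℕ; zero; suc; _<_)
open import Data.Fin using (Fin)
open import Data.Product using (Σ; ∃; _×_; _,_)
open import Relation.Binary.PropositionalEquality using (_≡_; _≢_)
open import Relation.Nullary using (¬_)
open import Algebra.Bundles using (Group)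

record Graph : Set₁ where
  field
    V      : Set
    Adj    : V → V → Set
    sym    : ∀ {u v} → Adj u v → Adj v u
    irrefl : ∀ {u} → ¬ Adj u u

module _ (X : Graph) where
  open Graph X

  data Walk : V → V → ℕ → Set where
    here : ∀ {u} → Walk u u zero
    step : ∀ {u v w n} → Adj u v → Walk v w n → Walk u w (suc n)

  HasDist : V → V → ℕ → Set
  HasDist u v n = Walk u v n × (∀ m → m < n → ¬ Walk u v m)

  Connected : Set
  Connected = ∀ u v → ∃ λ n → Walk u v n

  Regular : ℕ → Set
  Regular k = ∀ v → Σ (Fin k → V) λ nb →
                  (∀ i → Adj v (nb i))
                × (∀ i j → nb i ≡ nb j → i ≡ j)
                × (∀ w → Adj v w → ∃ λ i → nb i ≡ w)

record AutAction {c ℓ : Level} (Λ : Group c ℓ) (X : Graph) : Set (c ⊔ ℓ) where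
  open Group Λ
  open Graph X
  field
    act       : Carrier → V → V
    act-ε     : ∀ v → act ε v ≡ v
    act-∙     : ∀ g h v → act (g ∙ h) v ≡ act g (act h v)
    act-cong  : ∀ {g h} → g ≈ h → ∀ v → act g v ≡ act h v
    act-adj   : ∀ g {u w} → Adj u w → Adj (act g u) (act g w)
    act-adj⁻  : ∀ g {u w} → Adj (act g u) (act g w) → Adj u w

module _ {c ℓ : Level} {Λ : Group c ℓ} {X : Graph} (A : AutAction Λ X) (v₀ : Graph.V X) where
  open Group Λ
  open AutAction A

  InStab : Carrier → Set
  InStab g = act g v₀ ≡ v₀

  InS : Carrier → Set
  InS g = HasDist X (act g v₀) v₀ 1

  -- s C = t C  (as left cosets of C)
  SameCoset : Carrier → Carrier → Set
  SameCoset s t = InStab (s ⁻¹ ∙ t)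

  -- |S / C| = k : there are exactly k distinct cosets sC with s ∈ S
  CosetCount : ℕ → Set c
  CosetCount k = Σ (Fin k → Carrier) λ f →
                     (∀ i → InS (f i))
                   × (∀ i j → SameCoset (f i) (f j) → i ≡ j)
                   × (∀ s → InS s → ∃ λ i → SameCoset s (f i))

  VertexTransitive : Set c
  VertexTransitive = ∀ u w → ∃ λ g → act g u ≡ w

{-# OPTIONS --safe #-}
module Submission where

-- Let C = Stab(v₀). If s C ≠ t C then s.v₀ ≠ t.v₀, so the k distinct cosets of S/C move v₀
-- to k distinct neighbours of v₀; as v₀ has only k neighbours, every neighbour of v₀ lies
-- in the orbit Λ.v₀. Translating by g, every neighbour of a vertex g.v₀ lies in the orbit
-- too, so the orbit is closed under adjacency and, X being connected, is all of X.

open import Defs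
open import Level using (Level)
open import Data.Nat using (ℕ; suc)
open import Data.Nat.Properties using (1+n≰n)
open import Data.Fin using (Fin; punchOut)
open import Data.Fin.Properties using (any?; _≟_; injective⇒≤; punchOut-injective)
open import Data.Product using (∃; _,_; proj₁; proj₂)
open import Function using (_∘_)
open import Function.Definitions using (Injective)
open import Relation.Binary.PropositionalEquality
open import Relation.Nullary using (yes; no; contradiction)
open import Algebra.Bundles using (Group)

injective⇒surjective : ∀ {n} (h : Fin n → Fin n) → Injective _≡_ _≡_ h →
                       ∀ j → ∃ λ i → h i ≡ j
injective⇒surjective {suc n} h h-inj j with any? (λ i → h i ≟ j)
... | yes hit = hit
... | no miss = contradiction (injective⇒≤ h′-inj) 1+n≰n
  where
  j≢h : ∀ i → j ≢ h i
  j≢h i = miss ∘ (i ,_) ∘ sym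

  h′ : Fin (suc n) → Fin n
  h′ i = punchOut (j≢h i)

  h′-inj : Injective _≡_ _≡_ h′
  h′-inj eq = h-inj (punchOut-injective (j≢h _) (j≢h _) eq)

walk₁⇒Adj : ∀ {X : Graph} {u w} → Walk X u w 1 → Graph.Adj X u w
walk₁⇒Adj (step u~w here) = u~w

module AutActionProperties {c ℓ : Level} {Λ : Group c ℓ} {X : Graph} (A : AutAction Λ X) where
  open Group Λ using (Carrier; ε; _∙_; _⁻¹; inverseˡ; inverseʳ)
  open Graph X using (V; Adj) renaming (sym to Adj-sym)
  open AutAction A
  open ≡-Reasoning

  act-cancelˡ : ∀ g v → act (g ⁻¹) (act g v) ≡ v
  act-cancelˡ g v = begin
    act (g ⁻¹) (act g v) ≡⟨ act-∙ (g ⁻¹) g v ⟨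
    act (g ⁻¹ ∙ g) v     ≡⟨ act-cong (inverseˡ g) v ⟩
    act ε v              ≡⟨ act-ε v ⟩
    v                    ∎

  act-cancelʳ : ∀ g v → act g (act (g ⁻¹) v) ≡ v
  act-cancelʳ g v = begin
    act g (act (g ⁻¹) v) ≡⟨ act-∙ g (g ⁻¹) v ⟨
    act (g ∙ g ⁻¹) v     ≡⟨ act-cong (inverseʳ g) v ⟩
    act ε v              ≡⟨ act-ε v ⟩
    v                    ∎

  module _ (v₀ : V) where

    InOrbit : V → Set c
    InOrbit w = ∃ λ g → act g v₀ ≡ w

    act≡⇒SameCoset : ∀ s t → act s v₀ ≡ act t v₀ → SameCoset A v₀ s t
    act≡⇒SameCoset s t s·v₀≡t·v₀ = begin
      act (s ⁻¹ ∙ t) v₀     ≡⟨ act-∙ (s ⁻¹) t v₀ ⟩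
      act (s ⁻¹) (act t v₀) ≡⟨ cong (act (s ⁻¹)) s·v₀≡t·v₀ ⟨
      act (s ⁻¹) (act s v₀) ≡⟨ act-cancelˡ s v₀ ⟩
      v₀                    ∎

    neighbours-InOrbit : ∀ {k} (nb : Fin k → V) → (∀ w → Adj v₀ w → ∃ λ i → nb i ≡ w) →
                         (f : Fin k → Carrier) → (∀ i → InS A v₀ (f i)) →
                         (∀ i j → SameCoset A v₀ (f i) (f j) → i ≡ j) →
                         ∀ {w} → Adj v₀ w → InOrbit w
    neighbours-InOrbit {k} nb nb-onto f f∈S f-inj {w} v₀~w =
      let m , nb-m≡w    = nb-onto w v₀~w
          i , index-i≡m = injective⇒surjective index index-inj m
      in f i , (begin
        act (f i) v₀ ≡⟨ nb-index i ⟨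
        nb (index i) ≡⟨ cong nb index-i≡m ⟩
        nb m         ≡⟨ nb-m≡w ⟩
        w            ∎)
      where
      v₀~f·v₀ : ∀ i → Adj v₀ (act (f i) v₀)
      v₀~f·v₀ i = Adj-sym (walk₁⇒Adj (proj₁ (f∈S i)))

      index : Fin k → Fin k
      index i = proj₁ (nb-onto (act (f i) v₀) (v₀~f·v₀ i))

      nb-index : ∀ i → nb (index i) ≡ act (f i) v₀
      nb-index i = proj₂ (nb-onto (act (f i) v₀) (v₀~f·v₀ i))

      index-inj : Injective _≡_ _≡_ index
      index-inj {i} {j} eq = f-inj i j (act≡⇒SameCoset (f i) (f j) (begin
        act (f i) v₀ ≡⟨ nb-index i ⟨
        nb (index i) ≡⟨ cong nb eq ⟩
        nb (index j) ≡⟨ nb-index j ⟩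
        act (f j) v₀ ∎))

    module _ (neighbours : ∀ {w} → Adj v₀ w → InOrbit w) where

      InOrbit-Adj-closed : ∀ {u w} → Adj u w → InOrbit u → InOrbit w
      InOrbit-Adj-closed {w = w} u~w (g , g·v₀≡u) =
        let s , s·v₀≡g⁻¹·w = neighbours (act-adj⁻ g translated)
        in g ∙ s , (begin
          act (g ∙ s) v₀       ≡⟨ act-∙ g s v₀ ⟩
          act g (act s v₀)     ≡⟨ cong (act g) s·v₀≡g⁻¹·w ⟩
          act g (act (g ⁻¹) w) ≡⟨ act-cancelʳ g w ⟩
          w                    ∎)
        where
        translated : Adj (act g v₀) (act g (act (g ⁻¹) w))
        translated = subst₂ Adj (sym g·v₀≡u) (sym (act-cancelʳ g w)) u~w

      InOrbit-walk-start : ∀ {u w n} → Walk X u w n → InOrbit w → InOrbit u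
      InOrbit-walk-start here            w∈Λv₀ = w∈Λv₀
      InOrbit-walk-start (step u~v v⇝w) w∈Λv₀ =
        InOrbit-Adj-closed (Adj-sym u~v) (InOrbit-walk-start v⇝w w∈Λv₀)

      connected⇒InOrbit : Connected X → ∀ u → InOrbit u
      connected⇒InOrbit conn u = InOrbit-walk-start (proj₂ (conn u v₀)) (ε , act-ε v₀)

    InOrbit-all⇒VertexTransitive : (∀ u → InOrbit u) → VertexTransitive A v₀
    InOrbit-all⇒VertexTransitive orbit u w =
      let g , g·v₀≡u = orbit u
          h , h·v₀≡w = orbit w
      in h ∙ g ⁻¹ , (begin
        act (h ∙ g ⁻¹) u              ≡⟨ act-∙ h (g ⁻¹) u ⟩
        act h (act (g ⁻¹) u)          ≡⟨ cong (act h ∘ act (g ⁻¹)) g·v₀≡u ⟨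
        act h (act (g ⁻¹) (act g v₀)) ≡⟨ cong (act h) (act-cancelˡ g v₀) ⟩
        act h v₀                      ≡⟨ h·v₀≡w ⟩
        w                             ∎)

mainTheorem8 : {c ℓ : Level} (X : Graph) (k : ℕ) → Connected X → Regular X k →
               (v₀ : Graph.V X) (Λ : Group c ℓ) (A : AutAction Λ X) →
               CosetCount A v₀ k → VertexTransitive A v₀
mainTheorem8 X k conn reg v₀ Λ A (f , f∈S , f-inj , _) =
  let nb , _ , _ , nb-onto = reg v₀
      neighbours = neighbours-InOrbit v₀ nb nb-onto f f∈S f-inj
  in InOrbit-all⇒VertexTransitive v₀ (connected⇒InOrbit v₀ neighbours conn)
  where open AutActionProperties A
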